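{- Let $(G,k)$ be an instance of PITVD, let $S\subseteq V(G)$ be such that $G-S$ is a simple graph each of whose components is a proper interval graph or a tree, and let $V_2$ be the union of the vertex sets of the connected components of $G-S$ that are trees. If there is a vertex $v\in S$ such that $G[\{v\}\cup V_2]$ contains a $v$-flower of order $4k+3$, then every set $X\subseteq V(G)$ with $|X|\le k$ such that $G-X$ is a simple graph all of whose components are proper interval graphs or trees contains $v$; consequently $(G,k)$ is a yes-instance of PITVD if and only if $(G-v,k-1)$ is a yes-instance of PITVD.
   Context: PITVD: given an undirected (multi)graph $G$ without self-loops and an integer $k$, decide whether there is $X\subseteq V(G)$, $|X|\le k$, such that $G-X$ is a simple graph every connected component of which is a proper interval graph or a tree. A cycle may have length $2$ (two vertices joined by two parallel edges). For a vertex $v$, a \emph{$v$-flower} of order $\ell$ is a family of $\ell$ cycles each containing $v$ such that any two of them intersect only in $v$. -}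

module Defs where

open import Data.Nat using (ℕ; zero; suc; _≤_)
open import Data.Fin using (Fin; punchIn)
open import Data.Fin.Properties using (punchIn-injective)
open import Data.Fin.Subset using (Subset; _∈_; _∉_; ∣_∣)
open import Data.List using (List; []; _∷_; _∷ʳ_; length)
open import Data.List.Relation.Unary.All using (All)
open import Data.List.Relation.Unary.Unique.Propositional using (Unique)
import Data.List.Membership.Propositional as LM
open import Data.Integer as ℤ using (ℤ; +_)
open import Data.Rational as ℚ using (ℚ)
open import Data.Product using (Σ; ∃; _×_; _,_)
open import Data.Sum using (_⊎_)
open import Data.Unit using (⊤)
open import Data.Empty using (⊥)
open import Relation.Nullary using (¬_)
open import Relation.Binary.PropositionalEquality using (_≡_; _≢_)
open import Function.Bundles using (_⇔_)

-- Finite undirected multigraphs without self-loops on vertex set Fin n.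
-- mult x y = number of parallel edges between x and y.

record Graph (n : ℕ) : Set where
  field
    mult     : Fin n → Fin n → ℕ
    sym      : ∀ x y → mult x y ≡ mult y x
    loopless : ∀ x → mult x x ≡ 0
open Graph public

VSet : ℕ → Set₁
VSet n = Fin n → Set

-- complement of a finite subset (vertex set of G - X)
notIn : ∀ {n} → Subset n → VSet n
notIn X x = x ∉ X

_∈L_ : ∀ {n} → Fin n → List (Fin n) → Set
x ∈L c = x LM.∈ c

module _ {n : ℕ} (G : Graph n) where

  Adj : Fin n → Fin n → Set
  Adj x y = 1 ≤ mult G x y

  -- everything below refers to the induced subgraph G[U]

  Simple : VSet n → Set
  Simple U = ∀ x y → U x → U y → mult G x y ≤ 1

  data Reach (U : VSet n) : Fin n → Fin n → Set where
    here : ∀ {x} → U x → Reach U x x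
    step : ∀ {x y z} → U x → Adj x y → Reach U y z → Reach U x z

  Connected : VSet n → Set
  Connected U = ∀ x y → U x → U y → Reach U x y

  Component : VSet n → Fin n → VSet n
  Component U x y = Reach U x y

  ConsecAdj : List (Fin n) → Set
  ConsecAdj (x ∷ y ∷ r) = Adj x y × ConsecAdj (y ∷ r)
  ConsecAdj _           = ⊤

  -- cyclic edge condition; a cycle of length 2 needs two parallel edges
  CycleEdges : List (Fin n) → Set
  CycleEdges []                    = ⊥
  CycleEdges (a ∷ [])              = ⊥
  CycleEdges (a ∷ b ∷ [])          = 2 ≤ mult G a b
  CycleEdges (a ∷ b ∷ c ∷ r)       = ConsecAdj ((a ∷ b ∷ c ∷ r) ∷ʳ a)

  -- a cycle of G[U], given by its (distinct) vertices in cyclic order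
  IsCycle : VSet n → List (Fin n) → Set
  IsCycle U c = Unique c × All U c × CycleEdges c

  Acyclic : VSet n → Set
  Acyclic U = ∀ c → ¬ IsCycle U c

  IsTree : VSet n → Set
  IsTree U = (∃ λ x → U x) × Connected U × Acyclic U

  IsPIG : VSet n → Set
  IsPIG U = Σ (Fin n → ℚ) λ l → Σ (Fin n → ℚ) λ r →
      (∀ x → U x → l x ℚ.≤ r x)
    × (∀ x y → U x → U y → x ≢ y →
         (Adj x y ⇔ (l x ℚ.≤ r y × l y ℚ.≤ r x)))
    × (∀ x y → U x → U y →
         ¬ (l y ℚ.≤ l x × r x ℚ.≤ r y × (l x ≢ l y ⊎ r x ≢ r y)))

  Good : VSet n → Set
  Good U = Simple U × (∀ x → U x → IsPIG (Component U x) ⊎ IsTree (Component U x))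

  YesInstance : ℤ → Set
  YesInstance k = ∃ λ (X : Subset n) → (+ ∣ X ∣) ℤ.≤ k × Good (notIn X)

  V₂ : Subset n → VSet n
  V₂ S x = x ∉ S × IsTree (Component (notIn S) x)

  HasFlower : VSet n → Fin n → ℕ → Set
  HasFlower U v ℓ = Σ (Fin ℓ → List (Fin n)) λ cs →
      (∀ i → IsCycle U (cs i) × v ∈L cs i)
    × (∀ i j → i ≢ j → ∀ x → x ∈L cs i → x ∈L cs j → x ≡ v)

delete : ∀ {n} → Graph (suc n) → Fin (suc n) → Graph n
delete G v = record
  { mult     = λ x y → mult G (punchIn v x) (punchIn v y)
  ; sym      = λ x y → sym G (punchIn v x) (punchIn v y)
  ; loopless = λ x → loopless G (punchIn v x)
  }

{-# OPTIONS --safe #-}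
module Submission where

-- Suppose a solution X avoids v. A vertex of X other than v lies on at most
-- one petal, so at least 3k + 3 ≥ 3 petals survive in G - X, inside the
-- component C of v; C contains a cycle, so it is a proper interval graph.
-- The two neighbours of v on each petal lie in V₂, which spans no triangle
-- because its components in G - S are trees. But every neighbour of v in a
-- proper interval graph covers an endpoint of the interval of v, so the
-- neighbourhood of v is the union of two cliques and holds at most four
-- triangle-free vertices, not the six supplied by three petals. Once v is
-- forced, X ↦ X - v matches the solutions of (G, k) with those of (G - v, k - 1).

open import Defs
open import Data.Nat using (ℕ; zero; suc; _≤_; _<_; _*_; _+_; z≤n; s≤s)
open import Data.Nat.Properties
  using ( ≤-trans; <⇒≤; 1+n≰n; +-suc; +-comm; +-mono-≤; +-monoˡ-≤; +-monoʳ-≤; *-suc; *-cancelˡ-≤; m≤n*m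
        ; module ≤-Reasoning)
open import Data.Fin using (Fin; zero; suc; punchIn; punchOut; _≟_; _↑ʳ_)
open import Data.Fin.Properties using (punchInᵢ≢i; punchIn-punchOut; punchOut-punchIn; punchOut-cong)
open import Data.Fin.Subset using (Subset; _∈_; _∉_; ∣_∣; inside; outside; ⁅_⁆; _─_)
open import Data.Fin.Subset.Properties using (_∈?_; p─q⊆p; x∈p∧x≢y⇒x∈p-y; x∈p⇒∣p-x∣<∣p∣)
open import Data.Integer as ℤ using (+_; _-_)
import Data.Rational as ℚ
import Data.Rational.Properties as ℚ
open import Data.Vec using (_∷_; insertAt; removeAt)
open import Data.Vec.Properties
  using ([]=⇒lookup; lookup⇒[]=; insertAt-punchIn; insertAt-lookup; insertAt-removeAt)
open import Data.List using (List; []; _∷_; _∷ʳ_; length; filter; tabulate; map)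
open import Data.List.Properties using (length-tabulate; map-++)
open import Data.List.Membership.Propositional using (find; lose)
open import Data.List.Relation.Unary.All as All using (All; []; _∷_)
import Data.List.Relation.Unary.All.Properties as All
open import Data.List.Relation.Unary.AllPairs as AllPairs using ([]; _∷_)
import Data.List.Relation.Unary.AllPairs.Properties as AllPairs
open import Data.List.Relation.Unary.Any using (Any; here; there; any?)
open import Data.List.Relation.Unary.Unique.Propositional using (Unique)
import Data.List.Relation.Unary.Unique.Propositional.Properties as Unique
open import Data.List.Relation.Binary.Sublist.Propositional as Sublist using ([]; _∷_)
open import Data.List.Relation.Binary.Sublist.Propositional.Properties using (All-resp-⊆)
open import Data.Product using (∃; ∃₂; _×_; _,_; proj₁; proj₂)
open import Data.Sum using (_⊎_; inj₁; [_,_]′)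
import Data.Sum as Sum
open import Data.Unit using (tt)
open import Data.Empty using (⊥; ⊥-elim)
open import Relation.Nullary using (¬_; yes; no; does)
open import Data.Bool using (true; false)
open import Relation.Nullary.Decidable using (_×-dec_)
open import Relation.Unary using (Decidable; _∩_)
open import Relation.Unary.Properties using (∁?)
open import Relation.Binary.PropositionalEquality as ≡ using (_≡_; _≢_; refl; cong; subst; subst₂; ≢-sym)
open import Function using (_∘_; id)
open import Function.Bundles using (_⇔_; mk⇔; Equivalence)
import Function.Properties.Equivalence as ⇔

length-filter-∁ : ∀ {A : Set} {P : A → Set} (P? : Decidable P) xs →
  length (filter P? xs) + length (filter (∁? P?) xs) ≡ length xs
length-filter-∁ P? [] = refl
length-filter-∁ P? (x ∷ xs) with does (P? x)
... | true  = cong suc (length-filter-∁ P? xs)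
... | false = ≡.trans (+-suc _ _) (cong suc (length-filter-∁ P? xs))

Unique-map-on : ∀ {A B : Set} {P : A → Set} {f : A → B} {xs} →
  (∀ {x y} → P x → P y → f x ≡ f y → x ≡ y) → All P xs → Unique xs → Unique (map f xs)
Unique-map-on inj []        []               = []
Unique-map-on inj (px ∷ ps) (x∉xs ∷ distinct) =
  All.map⁺ (All.zipWith (λ (py , x≢y) → x≢y ∘ inj px py) (ps , x∉xs)) ∷ Unique-map-on inj ps distinct

Unique-∷ʳ : ∀ {A : Set} {x : A} {xs} → All (x ≢_) xs → Unique xs → Unique (xs ∷ʳ x)
Unique-∷ʳ [] [] = [] ∷ []
Unique-∷ʳ (x≢y ∷ x∉xs) (y∉xs ∷ distinct) = All.∷ʳ⁺ y∉xs (≢-sym x≢y) ∷ Unique-∷ʳ x∉xs distinct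

module _ {n} (G : Graph n) where

  Adj-sym : ∀ {x y} → Adj G x y → Adj G y x
  Adj-sym {x} {y} = subst (1 ≤_) (sym G x y)

  Adj⇒≢ : ∀ {x y} → Adj G x y → x ≢ y
  Adj⇒≢ {x} xx refl = 1+n≰n (subst (1 ≤_) (loopless G x) xx)

  module _ {U : VSet n} where

    Reach-start : ∀ {x y} → Reach G U x y → U x
    Reach-start (here ux)     = ux
    Reach-start (step ux _ _) = ux

    Reach-end : ∀ {x y} → Reach G U x y → U y
    Reach-end (here uy)    = uy
    Reach-end (step _ _ r) = Reach-end r

    Reach-trans : ∀ {x y z} → Reach G U x y → Reach G U y z → Reach G U x z
    Reach-trans (here _)       s = s
    Reach-trans (step ux xy r) s = step ux xy (Reach-trans r s)

    Reach-sym : ∀ {x y} → Reach G U x y → Reach G U y x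
    Reach-sym (here ux)       = here ux
    Reach-sym (step ux xy r) = Reach-trans (Reach-sym r) (step (Reach-start r) (Adj-sym xy) (here ux))

    ConsecAdj⇒Reach : ∀ {x xs} → ConsecAdj G (x ∷ xs) → All U (x ∷ xs) → All (Reach G U x) (x ∷ xs)
    ConsecAdj⇒Reach {xs = []} _ (ux ∷ []) = here ux ∷ []
    ConsecAdj⇒Reach {xs = _ ∷ _} (xy , walk) (ux ∷ us) =
      here ux ∷ All.map (step ux xy) (ConsecAdj⇒Reach walk us)

  ConsecAdj-∷ʳ⁻ : ∀ xs {y} → ConsecAdj G (xs ∷ʳ y) → ConsecAdj G xs
  ConsecAdj-∷ʳ⁻ []           _           = tt
  ConsecAdj-∷ʳ⁻ (_ ∷ [])     _           = tt
  ConsecAdj-∷ʳ⁻ (_ ∷ x ∷ xs) (xx , walk) = xx , ConsecAdj-∷ʳ⁻ (x ∷ xs) walk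

  CycleEdges⇒ConsecAdj : ∀ c → CycleEdges G c → ConsecAdj G c
  CycleEdges⇒ConsecAdj (a ∷ b ∷ [])    ab   = <⇒≤ ab , tt
  CycleEdges⇒ConsecAdj (a ∷ b ∷ d ∷ r) walk = ConsecAdj-∷ʳ⁻ (a ∷ b ∷ d ∷ r) walk

  IsCycle-mono : ∀ {U W c} → (∀ {x} → x ∈L c → U x → W x) → IsCycle G U c → IsCycle G W c
  IsCycle-mono U⇒W (distinct , inU , edges) =
    distinct , All.tabulate (λ x∈c → U⇒W x∈c (All.lookup inU x∈c)) , edges

  IsCycle⇒Component : ∀ {U v c} → IsCycle G U c → v ∈L c → IsCycle G (Component G U v) c
  IsCycle⇒Component {c = a ∷ c} (distinct , inU , edges) v∈c =
    distinct , All.map (Reach-trans (Reach-sym (All.lookup reach v∈c))) reach , edges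
    where reach = ConsecAdj⇒Reach (CycleEdges⇒ConsecAdj (a ∷ c) edges) inU

  tree-component-acyclic : ∀ {U v c} → IsTree G (Component G U v) → IsCycle G U c → v ∈L c → ⊥
  tree-component-acyclic (_ , _ , acyclic) cycle v∈c = acyclic _ (IsCycle⇒Component cycle v∈c)

  TriangleFree : VSet n → Set
  TriangleFree T = ∀ {x y z} → T x → T y → T z → Adj G x y → Adj G y z → Adj G z x → ⊥

  V₂-triangle-free : ∀ S → TriangleFree (V₂ G S)
  V₂-triangle-free S (x∉S , tree) (y∉S , _) (z∉S , _) xy yz zx =
    tree-component-acyclic tree (distinct , (x∉S ∷ y∉S ∷ z∉S ∷ []) , (xy , yz , zx , tt)) (here refl)
    where
      distinct = (Adj⇒≢ xy ∷ ≢-sym (Adj⇒≢ zx) ∷ []) ∷ (Adj⇒≢ yz ∷ []) ∷ [] ∷ []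

  IsClique : VSet n → Set
  IsClique Q = ∀ {x y} → Q x → Q y → x ≢ y → Adj G x y

  triangle-free-clique-size : ∀ {T Q xs} → TriangleFree T → IsClique Q → Unique xs → All (T ∩ Q) xs →
    length xs ≤ 2
  triangle-free-clique-size _ _ _ [] = z≤n
  triangle-free-clique-size _ _ _ (_ ∷ []) = s≤s z≤n
  triangle-free-clique-size _ _ _ (_ ∷ _ ∷ []) = s≤s (s≤s z≤n)
  triangle-free-clique-size triangle-free clique
    ((x≢y ∷ x≢z ∷ _) ∷ (y≢z ∷ _) ∷ _) ((tx , qx) ∷ (ty , qy) ∷ (tz , qz) ∷ _) =
    ⊥-elim (triangle-free tx ty tz (clique qx qy x≢y) (clique qy qz y≢z) (clique qz qx (≢-sym x≢z)))

  module ProperIntervalModel {U : VSet n} (pig : IsPIG G U) where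

    l r : Fin n → ℚ.ℚ
    l = proj₁ pig
    r = proj₁ (proj₂ pig)

    Covers : Fin n → ℚ.ℚ → Set
    Covers x q = l x ℚ.≤ q × q ℚ.≤ r x

    covers? : ∀ q → Decidable (λ x → Covers x q)
    covers? q x = (l x ℚ.≤? q) ×-dec (q ℚ.≤? r x)

    Adj⇔overlap : ∀ {x y} → U x → U y → x ≢ y → Adj G x y ⇔ (l x ℚ.≤ r y × l y ℚ.≤ r x)
    Adj⇔overlap = proj₁ (proj₂ (proj₂ (proj₂ pig))) _ _

    not-nested : ∀ {x y} → U x → U y → ¬ (l y ℚ.≤ l x × r x ℚ.≤ r y × (l x ≢ l y ⊎ r x ≢ r y))
    not-nested = proj₂ (proj₂ (proj₂ (proj₂ pig))) _ _

    common-point-clique : ∀ q → IsClique (U ∩ λ x → Covers x q)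
    common-point-clique q (ux , lx≤q , q≤rx) (uy , ly≤q , q≤ry) x≢y =
      Equivalence.from (Adj⇔overlap ux uy x≢y) (ℚ.≤-trans lx≤q q≤ry , ℚ.≤-trans ly≤q q≤rx)

    -- A neighbour whose interval misses l v starts to the right of l v, so,
    -- not being nested in the interval of v, it must end to the right of r v.
    neighbour-covers-r : ∀ {v u} → U v → U u → Adj G v u → ¬ Covers u (l v) → Covers u (r v)
    neighbour-covers-r {v} {u} uv uu vu ¬covers-lv = lu≤rv , ℚ.<⇒≤ (ℚ.≰⇒> ru≰rv)
      where
        overlapping = Equivalence.to (Adj⇔overlap uv uu (Adj⇒≢ vu)) vu
        lu≤rv = proj₂ overlapping
        lv<lu = ℚ.≰⇒> (λ lu≤lv → ¬covers-lv (lu≤lv , proj₁ overlapping))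
        ru≰rv : ¬ r u ℚ.≤ r v
        ru≰rv ru≤rv = not-nested uu uv (ℚ.<⇒≤ lv<lu , ru≤rv , inj₁ (≢-sym (ℚ.<⇒≢ lv<lu)))

    triangle-free-neighbourhood-size : ∀ {T v xs} → TriangleFree T → U v → Unique xs →
      All (λ u → U u × Adj G v u × T u) xs → length xs ≤ 4
    triangle-free-neighbourhood-size {T} {v} {xs} triangle-free uv distinct nbrs = begin
      length xs                                     ≡⟨ length-filter-∁ L? xs ⟨
      length (filter L? xs) + length (filter R? xs) ≤⟨ +-mono-≤ left-size right-size ⟩
      2 + 2                                         ∎
      where
        open ≤-Reasoning
        L? = covers? (l v)
        R? = ∁? L?
        side-size : ∀ {P} (P? : Decidable P) q → (∀ {u} → U u × Adj G v u × T u → P u → Covers u q) →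
          length (filter P? xs) ≤ 2
        side-size P? q covering = triangle-free-clique-size triangle-free (common-point-clique q)
          (Unique.filter⁺ P? distinct)
          (All.zipWith (λ (nbr@(uu , _ , tu) , pu) → tu , uu , covering nbr pu)
            (All.filter⁺ P? nbrs , All.all-filter P? xs))
        left-size = side-size L? (l v) (λ _ covers → covers)
        right-size = side-size R? (r v) (λ (uu , vu , _) → neighbour-covers-r uv uu vu)

  TwoNeighboursIn : VSet n → Fin n → Set
  TwoNeighboursIn P v = ∃₂ λ p q → p ≢ q × (P ∩ Adj G v) p × (P ∩ Adj G v) q

  path-neighbours : ∀ {P v} x t y →
    ConsecAdj G (x ∷ t ∷ʳ y) → Unique (x ∷ t ∷ʳ y) → All P (x ∷ t ∷ʳ y) → v ∈L t → TwoNeighboursIn P v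
  path-neighbours x (_ ∷ []) y (xv , vy , _) ((_ ∷ x≢y ∷ []) ∷ _) (px ∷ _ ∷ py ∷ []) (here refl) =
    x , y , x≢y , (px , Adj-sym xv) , (py , vy)
  path-neighbours x (_ ∷ u ∷ t) y (xv , vu , _) ((_ ∷ x≢u ∷ _) ∷ _) (px ∷ _ ∷ pu ∷ _) (here refl) =
    x , u , x≢u , (px , Adj-sym xv) , (pu , vu)
  path-neighbours x (u ∷ t) y (_ , walk) (_ ∷ distinct) (_ ∷ ps) (there v∈t) =
    path-neighbours u t y walk distinct ps v∈t

  last-edge : ∀ x t {y} → ConsecAdj G (x ∷ t ∷ʳ y) → ∃ λ z → z ∈L (x ∷ t) × Adj G z y
  last-edge x []       (xy , _)   = x , here refl , xy
  last-edge x (x′ ∷ t) (_ , walk) = let z , z∈ , zy = last-edge x′ t walk in z , there z∈ , zy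

  cycle-neighbours : ∀ {U v c} → Simple G U → IsCycle G U c → v ∈L c → TwoNeighboursIn (_∈L c) v
  cycle-neighbours {c = a ∷ b ∷ []} simple (_ , (ua ∷ ub ∷ []) , ab) _ =
    ⊥-elim (1+n≰n (≤-trans ab (simple a b ua ub)))
  cycle-neighbours {c = a ∷ b ∷ d ∷ r} _ ((_ ∷ b∉ ∷ _) , _ , ab , walk) (here refl) =
    let z , z∈ , za = last-edge d r (proj₂ walk)
    in b , z , All.lookup b∉ z∈ , (there (here refl) , ab) , (there (there z∈) , Adj-sym za)
  cycle-neighbours {c = a ∷ b ∷ d ∷ r} _ (((_ ∷ a≢d ∷ _) ∷ _) , _ , ab , bd , _) (there (here refl)) =
    a , d , a≢d , (here refl , Adj-sym ab) , (there (there (here refl)) , bd)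
  cycle-neighbours {c = a ∷ b ∷ d ∷ r} _ ((a∉ ∷ distinct) , _ , _ , walk) (there (there v∈)) =
    path-neighbours b (d ∷ r) a walk (Unique-∷ʳ a∉ distinct)
      (All.∷ʳ⁺ (All.tabulate there) (here refl)) v∈

  MeetOnlyAt : Fin n → List (Fin n) → List (Fin n) → Set
  MeetOnlyAt v c c′ = ∀ {x} → x ∈L c → x ∈L c′ → x ≡ v

  IsFlower : VSet n → Fin n → List (List (Fin n)) → Set
  IsFlower U v cs = All (λ c → IsCycle G U c × v ∈L c) cs × AllPairs.AllPairs (MeetOnlyAt v) cs

  HasFlower⇒IsFlower : ∀ {U v ℓ} → HasFlower G U v ℓ → ∃ λ cs → length cs ≡ ℓ × IsFlower U v cs
  HasFlower⇒IsFlower (cs , petals , meet) =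
    tabulate cs , length-tabulate cs , All.tabulate⁺ petals ,
    AllPairs.tabulate⁺ (λ i≢j x∈ x∈′ → meet _ _ i≢j _ x∈ x∈′)

  flower-avoiding : ∀ {U v} X → v ∉ X → ∀ {cs} → IsFlower U v cs →
    ∃ λ cs′ → cs′ Sublist.⊆ cs × IsFlower (U ∩ notIn X) v cs′ × length cs ≤ length cs′ + ∣ X ∣
  flower-avoiding X v∉X {[]} _ = [] , [] , ([] , []) , z≤n
  flower-avoiding {U} {v} X v∉X {c ∷ cs} ((petal ∷ petals) , (meets ∷ pairs)) with any? (_∈? X) c
  ... | no c∩X≡∅ =
    let cs′ , cs′⊆cs , (petals′ , pairs′) , count = flower-avoiding X v∉X (petals , pairs)
    in c ∷ cs′ , refl ∷ cs′⊆cs ,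
       ((IsCycle-mono (λ x∈c ux → ux , c∩X≡∅ ∘ lose x∈c) (proj₁ petal) , proj₂ petal) ∷ petals′ ,
        All-resp-⊆ cs′⊆cs meets ∷ pairs′) ,
       s≤s count
  ... | yes c∩X≢∅ with find c∩X≢∅
  ... | x , x∈c , x∈X =
    let cs′ , cs′⊆cs , (petals′ , pairs′) , count =
          flower-avoiding (X ─ ⁅ x ⁆) (v∉X ∘ p─q⊆p X ⁅ x ⁆) (petals , pairs)
    in cs′ , c Sublist.∷ʳ cs′⊆cs ,
       (All.zipWith widen (petals′ , All-resp-⊆ cs′⊆cs meets) , pairs′) ,
       (begin
          suc (length cs)                 ≤⟨ s≤s count ⟩
          suc (length cs′ + ∣ X ─ ⁅ x ⁆ ∣) ≡⟨ +-suc (length cs′) _ ⟨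
          length cs′ + suc ∣ X ─ ⁅ x ⁆ ∣   ≤⟨ +-monoʳ-≤ (length cs′) (x∈p⇒∣p-x∣<∣p∣ x∈X) ⟩
          length cs′ + ∣ X ∣               ∎)
    where
      open ≤-Reasoning
      widen : ∀ {c′} → (IsCycle G (U ∩ notIn (X ─ ⁅ x ⁆)) c′ × v ∈L c′) × MeetOnlyAt v c c′ →
        IsCycle G (U ∩ notIn X) c′ × v ∈L c′
      widen ((cycle , v∈c′) , meet) = IsCycle-mono keep cycle , v∈c′
        where
          keep : ∀ {y} → y ∈L _ → (U ∩ notIn (X ─ ⁅ x ⁆)) y → (U ∩ notIn X) y
          keep y∈c′ (uy , y∉X-x) = uy , λ y∈X → y∉X-x (x∈p∧x≢y⇒x∈p-y y∈X
            λ { refl → v∉X (subst (_∈ X) (meet x∈c y∈c′) x∈X) })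

  flower-neighbours : ∀ {U v cs} → Simple G U → IsFlower U v cs →
    ∃ λ ns → Unique ns × length ns ≡ 2 * length cs × All (λ u → U u × Adj G v u × Any (u ∈L_) cs) ns
  flower-neighbours {cs = []} _ _ = [] , [] , refl , []
  flower-neighbours {U} {v} {c ∷ cs} simple (((cycle , v∈c) ∷ petals) , (meets ∷ pairs))
    with cycle-neighbours simple cycle v∈c | flower-neighbours simple (petals , pairs)
  ... | p , q , p≢q , (p∈c , vp) , (q∈c , vq) | ns , distinct , len , nbrs =
    p ∷ q ∷ ns ,
    (p≢q ∷ All.map (off-petal p∈c vp) nbrs) ∷ All.map (off-petal q∈c vq) nbrs ∷ distinct ,
    ≡.trans (cong (λ m → 2 + m) len) (≡.sym (*-suc 2 (length cs))) ,
    on-petal p∈c vp ∷ on-petal q∈c vq ∷ All.map (λ (uu , vu , u∈) → uu , vu , there u∈) nbrs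
    where
      on-petal : ∀ {w} → w ∈L c → Adj G v w → U w × Adj G v w × Any (w ∈L_) (c ∷ cs)
      on-petal w∈c vw = All.lookup (proj₁ (proj₂ cycle)) w∈c , vw , here w∈c

      off-petal : ∀ {w u} → w ∈L c → Adj G v w → U u × Adj G v u × Any (u ∈L_) cs → w ≢ u
      off-petal w∈c vw (_ , _ , u∈) refl =
        let c′ , c′∈cs , w∈c′ = find u∈ in Adj⇒≢ vw (≡.sym (All.lookup meets c′∈cs w∈c w∈c′))

  pig-petals : ∀ {S X v cs} → IsPIG G (Component G (notIn X) v) → v ∉ X → Simple G (notIn X) →
    IsFlower ((λ x → x ≡ v ⊎ V₂ G S x) ∩ notIn X) v cs → length cs ≤ 2
  pig-petals {S} {X} {v} {cs} pig v∉X simple flower =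
    let ns , distinct , len , nbrs = flower-neighbours (λ x y wx wy → simple x y (proj₂ wx) (proj₂ wy)) flower
    in *-cancelˡ-≤ 2 (begin
      2 * length cs ≡⟨ len ⟨
      length ns     ≤⟨ triangle-free-neighbourhood-size
                         (V₂-triangle-free S) (here v∉X) distinct (All.map placed nbrs) ⟩
      4             ∎)
    where
      open ≤-Reasoning
      open ProperIntervalModel pig
      placed : ∀ {u} → ((λ x → x ≡ v ⊎ V₂ G S x) ∩ notIn X) u × Adj G v u × Any (u ∈L_) cs →
        Component G (notIn X) v u × Adj G v u × V₂ G S u
      placed ((u∈V₂ , u∉X) , vu , _) =
        step v∉X vu (here u∉X) , vu , [ (λ { refl → ⊥-elim (Adj⇒≢ vu refl) }) , id ]′ u∈V₂

  tree-component-has-no-petals : ∀ {U X v cs} → IsTree G (Component G (notIn X) v) →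
    IsFlower (U ∩ notIn X) v cs → cs ≡ []
  tree-component-has-no-petals _    ([] , _) = refl
  tree-component-has-no-petals tree (((cycle , v∈c) ∷ _) , _) =
    ⊥-elim (tree-component-acyclic tree (IsCycle-mono (λ _ → proj₂) cycle) v∈c)

  flower-order-bound : ∀ {S X v cs} → v ∉ X → Good G (notIn X) →
    IsFlower (λ x → x ≡ v ⊎ V₂ G S x) v cs → length cs ≤ 2 + ∣ X ∣
  flower-order-bound {X = X} {v} v∉X (simple , components) flower =
    let cs′ , _ , flower′ , count = flower-avoiding X v∉X flower
    in ≤-trans count (+-monoˡ-≤ ∣ X ∣ (
         [ (λ pig → pig-petals pig v∉X simple flower′)
         , (λ tree → subst (λ cs → length cs ≤ 2)
                             (≡.sym (tree-component-has-no-petals tree flower′)) z≤n)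
         ]′ (components v v∉X)))

  solutions-contain-flower-centre : ∀ {S v} k → HasFlower G (λ x → x ≡ v ⊎ V₂ G S x) v (4 * k + 3) →
    ∀ X → ∣ X ∣ ≤ k → Good G (notIn X) → v ∈ X
  solutions-contain-flower-centre {v = v} k has-flower X ∣X∣≤k good with v ∈? X
  ... | yes v∈X = v∈X
  ... | no v∉X =
    let cs , len , flower = HasFlower⇒IsFlower has-flower
    in ⊥-elim (1+n≰n (begin
      3 + k      ≤⟨ +-monoʳ-≤ 3 (m≤n*m k 4) ⟩
      3 + 4 * k  ≡⟨ +-comm 3 (4 * k) ⟩
      4 * k + 3  ≡⟨ len ⟨
      length cs  ≤⟨ flower-order-bound v∉X good flower ⟩
      2 + ∣ X ∣  ≤⟨ +-monoʳ-≤ 2 ∣X∣≤k ⟩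
      2 + k      ∎))
    where open ≤-Reasoning

one-vertex-acyclic : (G : Graph 1) (U : VSet 1) → Acyclic G U
one-vertex-acyclic G U (zero ∷ zero ∷ _) (((zero≢zero ∷ _) ∷ _) , _) = zero≢zero refl
one-vertex-acyclic G U [] (_ , _ , ())
one-vertex-acyclic G U (_ ∷ []) (_ , _ , ())

record InducedIso {a b} (G : Graph a) (U : VSet a) (H : Graph b) (W : VSet b) : Set where
  field
    to      : Fin a → Fin b
    from    : Fin b → Fin a
    to-∈    : ∀ {x} → U x → W (to x)
    from-∈  : ∀ {y} → W y → U (from y)
    from-to : ∀ {x} → U x → from (to x) ≡ x
    to-from : ∀ {y} → W y → to (from y) ≡ y
    mult-to : ∀ {x x′} → U x → U x′ → mult H (to x) (to x′) ≡ mult G x x′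

  mult-from : ∀ {y y′} → W y → W y′ → mult G (from y) (from y′) ≡ mult H y y′
  mult-from wy wy′ =
    ≡.trans (≡.sym (mult-to (from-∈ wy) (from-∈ wy′))) (≡.cong₂ (mult H) (to-from wy) (to-from wy′))

InducedIso-sym : ∀ {a b} {G : Graph a} {U} {H : Graph b} {W} → InducedIso G U H W → InducedIso H W G U
InducedIso-sym I = record
  { to = from ; from = to ; to-∈ = from-∈ ; from-∈ = to-∈
  ; from-to = to-from ; to-from = from-to ; mult-to = mult-from
  }
  where open InducedIso I

module _ {a b} {G : Graph a} {U} {H : Graph b} {W} (I : InducedIso G U H W) where
  open InducedIso I

  Adj-to : ∀ {x y} → U x → U y → Adj G x y → Adj H (to x) (to y)
  Adj-to ux uy = subst (1 ≤_) (≡.sym (mult-to ux uy))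

  to-injective : ∀ {x y} → U x → U y → to x ≡ to y → x ≡ y
  to-injective ux uy tx≡ty = ≡.trans (≡.sym (from-to ux)) (≡.trans (cong from tx≡ty) (from-to uy))

  Reach-to : ∀ {x y} → Reach G U x y → Reach H W (to x) (to y)
  Reach-to (here ux)      = here (to-∈ ux)
  Reach-to (step ux xy r) = step (to-∈ ux) (Adj-to ux (Reach-start G r) xy) (Reach-to r)

  ConsecAdj-to : ∀ {xs} → All U xs → ConsecAdj G xs → ConsecAdj H (map to xs)
  ConsecAdj-to []               _           = tt
  ConsecAdj-to (_ ∷ [])         _           = tt
  ConsecAdj-to (ux ∷ uy ∷ us) (xy , walk) = Adj-to ux uy xy , ConsecAdj-to (uy ∷ us) walk

  IsCycle-to : ∀ {c} → IsCycle G U c → IsCycle H W (map to c)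
  IsCycle-to {c} (distinct , inU , edges) =
    Unique-map-on to-injective inU distinct , All.map⁺ (All.map to-∈ inU) , cycle-edges c inU edges
    where
      cycle-edges : ∀ c → All U c → CycleEdges G c → CycleEdges H (map to c)
      cycle-edges (x ∷ y ∷ [])    (ux ∷ uy ∷ []) xy = subst (2 ≤_) (≡.sym (mult-to ux uy)) xy
      cycle-edges (x ∷ y ∷ z ∷ r) us           walk =
        subst (ConsecAdj H) (map-++ to (x ∷ y ∷ z ∷ r) (x ∷ []))
          (ConsecAdj-to (All.∷ʳ⁺ us (All.head us)) walk)

IsPIG-transport : ∀ {a b} {G : Graph a} {U} {H : Graph b} {W} → InducedIso G U H W → IsPIG G U → IsPIG H W
IsPIG-transport {G = G} {H = H} {W = W} I (l , r , l≤r , adj⇔ , proper) =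
  l ∘ from , r ∘ from ,
  (λ y wy → l≤r (from y) (from-∈ wy)) ,
  (λ y z wy wz y≢z → ⇔.trans (Adj⇔Adj-from wy wz)
     (adj⇔ (from y) (from z) (from-∈ wy) (from-∈ wz) (y≢z ∘ to-injective (InducedIso-sym I) wy wz))) ,
  (λ y z wy wz → proper (from y) (from z) (from-∈ wy) (from-∈ wz))
  where
    open InducedIso I
    Adj⇔Adj-from : ∀ {y z} → W y → W z → Adj H y z ⇔ Adj G (from y) (from z)
    Adj⇔Adj-from wy wz = mk⇔ (subst (1 ≤_) (≡.sym (mult-from wy wz))) (subst (1 ≤_) (mult-from wy wz))

IsTree-transport : ∀ {a b} {G : Graph a} {U} {H : Graph b} {W} → InducedIso G U H W → IsTree G U → IsTree H W
IsTree-transport {H = H} {W = W} I ((x , ux) , connected , acyclic) =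
  (to x , to-∈ ux) ,
  (λ y z wy wz → subst₂ (Reach H W) (to-from wy) (to-from wz)
     (Reach-to I (connected _ _ (from-∈ wy) (from-∈ wz)))) ,
  (λ c cycle → acyclic (map from c) (IsCycle-to (InducedIso-sym I) cycle))
  where open InducedIso I

component-iso : ∀ {a b} {G : Graph a} {U} {H : Graph b} {W} → (I : InducedIso G U H W) → ∀ {y} → W y →
  InducedIso G (Component G U (InducedIso.from I y)) H (Component H W y)
component-iso {G = G} {H = H} {W = W} I wy = record
  { to = to ; from = from
  ; to-∈ = λ r → subst (λ z → Reach H W z _) (to-from wy) (Reach-to I r)
  ; from-∈ = Reach-to (InducedIso-sym I)
  ; from-to = from-to ∘ Reach-end G
  ; to-from = to-from ∘ Reach-end H
  ; mult-to = λ r r′ → mult-to (Reach-end G r) (Reach-end G r′)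
  }
  where open InducedIso I

Good-transport : ∀ {a b} {G : Graph a} {U} {H : Graph b} {W} → InducedIso G U H W → Good G U → Good H W
Good-transport I (simple , components) =
  (λ y y′ wy wy′ → subst (_≤ 1) (mult-from wy wy′) (simple _ _ (from-∈ wy) (from-∈ wy′))) ,
  (λ y wy → Sum.map (IsPIG-transport (component-iso I wy)) (IsTree-transport (component-iso I wy))
                    (components (from y) (from-∈ wy)))
  where open InducedIso I

∣insertAt-inside∣ : ∀ {m} (X : Subset m) i → ∣ insertAt X i inside ∣ ≡ suc ∣ X ∣
∣insertAt-inside∣ X             zero    = refl
∣insertAt-inside∣ (inside ∷ X)  (suc i) = cong suc (∣insertAt-inside∣ X i)
∣insertAt-inside∣ (outside ∷ X) (suc i) = ∣insertAt-inside∣ X i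

+m≤+k-1⇔m<k : ∀ {m} k → + m ℤ.≤ + k - + 1 ⇔ m < k
+m≤+k-1⇔m<k zero    = mk⇔ (λ ()) (λ ())
+m≤+k-1⇔m<k (suc k) = mk⇔ (λ { (ℤ.+≤+ m≤k) → s≤s m≤k }) (λ { (s≤s m≤k) → ℤ.+≤+ m≤k })

module _ {n} (G : Graph (suc (suc n))) (v : Fin (suc (suc n))) where

  -- A left inverse of punchIn v; the value at v itself is junk.
  punchOut-v : Fin (suc (suc n)) → Fin (suc n)
  punchOut-v y with v ≟ y
  ... | yes _   = zero
  ... | no v≢y = punchOut v≢y

  punchOut-v-≢ : ∀ {y} (v≢y : v ≢ y) → punchOut-v y ≡ punchOut v≢y
  punchOut-v-≢ {y} v≢y with v ≟ y
  ... | yes v≡y = ⊥-elim (v≢y v≡y)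
  ... | no _    = punchOut-cong v refl

  module _ (X : Subset (suc n)) where

    v∈insertAt : v ∈ insertAt X v inside
    v∈insertAt = lookup⇒[]= v _ (insertAt-lookup X v inside)

    punchIn-∈⁺ : ∀ {x} → x ∈ X → punchIn v x ∈ insertAt X v inside
    punchIn-∈⁺ {x} x∈X = lookup⇒[]= _ _ (≡.trans (insertAt-punchIn X v inside x) ([]=⇒lookup x∈X))

    punchIn-∈⁻ : ∀ {x} → punchIn v x ∈ insertAt X v inside → x ∈ X
    punchIn-∈⁻ {x} x∈ = lookup⇒[]= x X (≡.trans (≡.sym (insertAt-punchIn X v inside x)) ([]=⇒lookup x∈))

    punchIn-punchOut-v : ∀ {y} → y ∉ insertAt X v inside → punchIn v (punchOut-v y) ≡ y
    punchIn-punchOut-v y∉ = ≡.trans (cong (punchIn v) (punchOut-v-≢ v≢y)) (punchIn-punchOut v≢y)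
      where v≢y = λ { refl → y∉ v∈insertAt }

    delete-iso : InducedIso (delete G v) (notIn X) G (notIn (insertAt X v inside))
    delete-iso = record
      { to = punchIn v
      ; from = punchOut-v
      ; to-∈ = λ x∉X → x∉X ∘ punchIn-∈⁻
      ; from-∈ = λ y∉ y∈X → y∉ (subst (_∈ insertAt X v inside) (punchIn-punchOut-v y∉) (punchIn-∈⁺ y∈X))
      ; from-to = λ {x} _ → ≡.trans (punchOut-v-≢ (punchInᵢ≢i v x ∘ ≡.sym)) (punchOut-punchIn v)
      ; to-from = punchIn-punchOut-v
      ; mult-to = λ _ _ → refl
      }

  YesInstance-delete : ∀ k → (∀ X → ∣ X ∣ ≤ k → Good G (notIn X) → v ∈ X) →
    YesInstance G (+ k) ⇔ YesInstance (delete G v) (+ k - + 1)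
  YesInstance-delete k solutions-contain-v = mk⇔ shrink grow
    where
      shrink : YesInstance G (+ k) → YesInstance (delete G v) (+ k - + 1)
      shrink (X , ℤ.+≤+ ∣X∣≤k , good) =
        removeAt X v ,
        Equivalence.from (+m≤+k-1⇔m<k k)
          (subst (_≤ k) (≡.trans (cong ∣_∣ (≡.sym reinsert)) (∣insertAt-inside∣ _ v)) ∣X∣≤k) ,
        Good-transport (InducedIso-sym (delete-iso (removeAt X v))) (subst (Good G ∘ notIn) (≡.sym reinsert) good)
        where
          reinsert : insertAt (removeAt X v) v inside ≡ X
          reinsert = subst (λ b → insertAt (removeAt X v) v b ≡ X)
                       ([]=⇒lookup (solutions-contain-v X ∣X∣≤k good)) (insertAt-removeAt X v)

      grow : YesInstance (delete G v) (+ k - + 1) → YesInstance G (+ k)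
      grow (X , ∣X∣≤k-1 , good) =
        insertAt X v inside ,
        ℤ.+≤+ (subst (_≤ k) (≡.sym (∣insertAt-inside∣ X v)) (Equivalence.to (+m≤+k-1⇔m<k k) ∣X∣≤k-1)) ,
        Good-transport (delete-iso X) good

lemma11 : ∀ {n} (G : Graph (suc n)) (k : ℕ) (S : Subset (suc n)) →
    Good G (notIn S) →
    (v : Fin (suc n)) → v ∈ S →
    HasFlower G (λ x → x ≡ v ⊎ V₂ G S x) v (4 * k + 3) →
    (∀ (X : Subset (suc n)) → ∣ X ∣ ≤ k → Good G (notIn X) → v ∈ X)
    × (YesInstance G (+ k) ⇔ YesInstance (delete G v) (+ k - + 1))
lemma11 {zero} G k S _ v _ (cs , petals , _) =
  ⊥-elim (one-vertex-acyclic G _ (cs ((4 * k) ↑ʳ zero)) (proj₁ (petals ((4 * k) ↑ʳ zero))))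
lemma11 {suc n} G k S _ v _ flower =
  solutions-contain-v , YesInstance-delete G v k solutions-contain-v
  where solutions-contain-v = solutions-contain-flower-centre G k flower
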